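{- Let $n\ge 2$. In the weighted digraph $G_n$, every vertex has, for each $j\in\{1,\ldots,n-1\}$, exactly $j!$ in-arcs of weight $j$ and exactly $j!$ out-arcs of weight $j$. Consequently every vertex has in-degree and out-degree $L=1!+2!+\cdots+(n-1)!$, so $G_n$ is $L$-regular.
   Context: Let $\mathcal{S}_n$ be the set of permutations of $n$ distinct symbols $x_1,\ldots,x_n$, written as words $(a_1\cdots a_n)$. The digraph $G_n$ has vertex set $\mathcal{S}_n$; there is an arc from $p$ to $p'$ if and only if for some $j\in\{1,\ldots,n-1\}$ the last $n-j$ symbols of $p$ coincide (in order) with the first $n-j$ symbols of $p'$. The weight of such an arc is the least such $j$, i.e. the number of symbols that have to be erased on the left of $p$ so that the remaining last symbols of $p$ match the first symbols of $p'$. If no such $j$ exists there is no arc. -}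

module Defs where

open import Data.Nat using (ℕ; zero; suc; _∸_; _+_)
open import Data.Nat using (_!)
open import Data.Fin using (Fin; _≟_)
open import Data.Bool using (Bool; true; false; if_then_else_)
open import Data.Maybe using (Maybe; just; nothing)
open import Data.List using (List; take; drop)
open import Data.List.Properties using (≡-dec)
open import Data.Vec using (Vec; toList)
open import Data.Vec.Relation.Unary.Unique.Propositional using (Unique)
open import Data.Vec.Relation.Unary.AllPairs using (allPairs?)
open import Data.Product using (Σ; _,_)
open import Relation.Nullary using (¬?; does)
open import Relation.Nullary.Decidable using (True)
open import Relation.Binary.PropositionalEquality using (_≡_)

-- Symbols x_1..x_n are the elements of Fin n; a word a_1⋯a_n is a Vec (Fin n) n.
unique? : ∀ {n} (w : Vec (Fin n) n) → Relation.Nullary.Dec (Unique w)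
unique? = allPairs? (λ x y → ¬? (x ≟ y))

-- Vertices of G_n: the permutations of the n symbols, written as words
-- (words with pairwise distinct letters).  The proof component is
-- 'True', which has a unique inhabitant, so counting vertices is faithful.
Perm : ℕ → Set
Perm n = Σ (Vec (Fin n) n) (λ w → True (unique? w))

word : ∀ {n} → Perm n → List (Fin n)
word (w , _) = toList w

overlaps : ∀ {n} → Perm n → Perm n → ℕ → Bool
overlaps {n} p p' j = does (≡-dec _≟_ (drop j (word p)) (take (n ∸ j) (word p')))

firstFrom : ℕ → ℕ → (ℕ → Bool) → Maybe ℕ
firstFrom j zero    f = nothing
firstFrom j (suc k) f = if f j then just j else firstFrom (suc j) k f

-- Weight of the arc p → p': the least j ∈ {1,…,n-1} such that the last n-j
-- symbols of p equal the first n-j symbols of p'; 'nothing' = no arc.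
weight : ∀ {n} → Perm n → Perm n → Maybe ℕ
weight {n} p p' = firstFrom 1 (n ∸ 1) (overlaps p p')

factSum : ℕ → ℕ
factSum zero    = zero
factSum (suc m) = factSum m + (suc m) !

-- An arc p → q of weight j says that q starts with the last n − j symbols of p.  Since
-- the symbols of p are distinct, such an overlap determines the shift j, so the least-j
-- condition in the weight is automatic.  Hence the out-neighbours of weight j are the
-- words (last n − j symbols of p) ++ r with r an arrangement of the first j symbols of p,
-- and Lehmer codes count the j! arrangements.  Reversing every word reverses every arc
-- and keeps its weight, which turns in-neighbours into out-neighbours.  Summing over
-- j = 1, …, n − 1 gives the degree 1! + ⋯ + (n − 1)!.

module Submission where

open import Defs
open import Data.Nat using (ℕ; zero; suc; _≤_; _<_; _∸_; _+_; _!; s≤s; s≤s⁻¹; z≤n)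
open import Data.Nat.Properties
  using ( ≤-irrelevant; ≤-refl; ≤-trans; <⇒≤; <-trans; <-irrefl; <⇒≢; ≤⇒≯; 1+n≰n; 0<1+n
        ; +-identityʳ; +-suc; suc-injective; m<m+n; m≤n⇒m≤1+n; m≤n⇒m<n∨m≡n; m≤n⇒m⊓n≡m
        ; m∸n≤m; m∸[m∸n]≡n; m∸n+n≡m; m<n⇒0<n∸m )
open import Data.Fin using (Fin; zero; suc; punchIn; punchOut; _≟_)
open import Data.Fin.Properties
  using ( any?; injective⇒≤; punchOut-injective; punchIn-injective; punchInᵢ≢i; punchOut-punchIn
        ; +↔⊎; *↔× )
open import Data.Bool using (Bool; true; false)
open import Data.Bool.Properties using (T-irrelevant)
open import Data.Maybe using (just)
open import Data.Maybe.Properties using (just-injective)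
open import Data.List using (List; []; _∷_; _++_; take; drop; length; reverse)
open import Data.List.Properties
  using ( ≡-dec; ∷-injectiveˡ; ∷-injectiveʳ; ++-cancelˡ; length-++; length-take; length-drop
        ; take++drop≡id; reverse-++; reverse-involutive; length-reverse )
open import Data.List.Membership.Propositional using (_∈_)
open import Data.List.Membership.Propositional.Properties using (∈-++⁺ʳ; ∈-++⁻)
open import Data.List.Relation.Unary.Any using (here; there)
open import Data.List.Relation.Unary.All as All using (All; []; _∷_)
open import Data.List.Relation.Unary.AllPairs using ([]; _∷_)
open import Data.List.Relation.Unary.Unique.Propositional as List using ()
open import Data.List.Relation.Unary.Unique.Propositional.Properties using (take⁺; drop⁺; ++⁺)
open import Data.List.Relation.Binary.Disjoint.Propositional using (Disjoint)
open import Data.List.Relation.Binary.Permutation.Propositional using (↭-sym; ↭⇒↭ₛ)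
open import Data.List.Relation.Binary.Permutation.Propositional.Properties using (↭-reverse)
import Data.List.Relation.Binary.Permutation.Setoid.Properties as Permutationₛ
open import Data.Vec using (Vec; []; _∷_; toList; fromList; lookup; removeAt; cast)
open import Data.Vec.Properties
  using (toList-injective; cast-is-id; length-toList; toList-cast; toList∘fromList; removeAt-punchOut)
import Data.Vec.Relation.Unary.All.Properties as Allᵥ
open import Data.Vec.Relation.Unary.AllPairs using ([]; _∷_)
open import Data.Vec.Relation.Unary.Any using (index)
open import Data.Vec.Relation.Unary.Any.Properties using (lookup-index)
open import Data.Vec.Relation.Unary.Unique.Propositional using (Unique)
open import Data.Vec.Relation.Unary.Unique.Propositional.Properties using (lookup-injective)
open import Data.Vec.Membership.Propositional using () renaming (_∈_ to _∈ᵥ_; _∉_ to _∉ᵥ_)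
open import Data.Vec.Membership.Propositional.Properties
  using (∈-lookup; ∈-toList⁺; ∈-fromList⁺; ∈-fromList⁻)
open import Data.Product using (Σ; ∃; _×_; _,_; proj₁; proj₂)
open import Data.Product.Properties using (∃∃↔∃∃)
open import Data.Product.Function.NonDependent.Propositional using (_×-↔_)
open import Data.Product.Function.Dependent.Propositional using (Σ-↔)
open import Data.Sum using (_⊎_; inj₁; inj₂)
open import Data.Sum.Function.Propositional using (_⊎-↔_)
open import Data.Unit using (⊤; tt)
open import Data.Empty using (⊥; ⊥-elim)
open import Function using (_∘_; Injective)
open import Function.Bundles using (_↔_; _⇔_; mk↔ₛ′; mk⇔; mk⤖; Equivalence)
open import Function.Properties.Inverse using (↔-refl; ↔-sym; ↔-trans)
open import Function.Properties.Bijection using (⤖⇒↔)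
open import Function.Related.Propositional using (K-reflexive)
open import Function.Consequences.Propositional using (strictlySurjective⇒surjective)
open import Relation.Nullary using (Dec; yes; no; does; contradiction; Irrelevant)
open import Relation.Nullary.Decidable using (toWitness; fromWitness; dec-true; dec-false; does-⇔)
open import Relation.Binary.PropositionalEquality
open import Axiom.UniquenessOfIdentityProofs.WithK using (uip)

private
  variable
    A : Set
    c n : ℕ

take-length-++ : (xs ys : List A) → take (length xs) (xs ++ ys) ≡ xs
take-length-++ []       ys = refl
take-length-++ (x ∷ xs) ys = cong (x ∷_) (take-length-++ xs ys)

drop-length-++ : (xs ys : List A) → drop (length xs) (xs ++ ys) ≡ ys
drop-length-++ []       ys = refl
drop-length-++ (x ∷ xs) ys = drop-length-++ xs ys

reverse-drop : (k : ℕ) (xs : List A) → reverse (drop k xs) ≡ take (length xs ∸ k) (reverse xs)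
reverse-drop k xs = begin
  reverse (drop k xs)
    ≡⟨ take-length-++ (reverse (drop k xs)) (reverse (take k xs)) ⟨
  take (length (reverse (drop k xs))) (reverse (drop k xs) ++ reverse (take k xs))
    ≡⟨ cong₂ take (trans (length-reverse (drop k xs)) (length-drop k xs))
                  (sym (reverse-++ (take k xs) (drop k xs))) ⟩
  take (length xs ∸ k) (reverse (take k xs ++ drop k xs))
    ≡⟨ cong (take (length xs ∸ k) ∘ reverse) (take++drop≡id k xs) ⟩
  take (length xs ∸ k) (reverse xs) ∎
  where open ≡-Reasoning

reverse-take : (k : ℕ) (xs : List A) → reverse (take k xs) ≡ drop (length xs ∸ k) (reverse xs)
reverse-take k xs = begin
  reverse (take k xs)
    ≡⟨ drop-length-++ (reverse (drop k xs)) (reverse (take k xs)) ⟨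
  drop (length (reverse (drop k xs))) (reverse (drop k xs) ++ reverse (take k xs))
    ≡⟨ cong₂ drop (trans (length-reverse (drop k xs)) (length-drop k xs))
                  (sym (reverse-++ (take k xs) (drop k xs))) ⟩
  drop (length xs ∸ k) (reverse (take k xs ++ drop k xs))
    ≡⟨ cong (drop (length xs ∸ k) ∘ reverse) (take++drop≡id k xs) ⟩
  drop (length xs ∸ k) (reverse xs) ∎
  where open ≡-Reasoning

drop-∈ : ∀ k {x} (xs : List A) → x ∈ drop k xs → x ∈ xs
drop-∈ zero    xs       x∈ = x∈
drop-∈ (suc k) (_ ∷ xs) x∈ = there (drop-∈ k xs x∈)

-- drop i xs ≡ y ∷ _ says that y sits at position i of xs.
unique-drop-∷ : ∀ {xs : List A} {y ys zs} i j → List.Unique xs →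
                drop i xs ≡ y ∷ ys → drop j xs ≡ y ∷ zs → i ≡ j
unique-drop-∷ {xs = x ∷ xs} zero    zero    _         _  _  = refl
unique-drop-∷ {xs = x ∷ xs} zero    (suc j) (x∉ ∷ _)  eᵢ eⱼ with refl ← ∷-injectiveˡ eᵢ =
  ⊥-elim (All.lookup x∉ (drop-∈ j xs (subst (_ ∈_) (sym eⱼ) (here refl))) refl)
unique-drop-∷ {xs = x ∷ xs} (suc i) zero    (x∉ ∷ _)  eᵢ eⱼ with refl ← ∷-injectiveˡ eⱼ =
  ⊥-elim (All.lookup x∉ (drop-∈ i xs (subst (_ ∈_) (sym eᵢ) (here refl))) refl)
unique-drop-∷ {xs = x ∷ xs} (suc i) (suc j) (_ ∷ xs!) eᵢ eⱼ = cong suc (unique-drop-∷ i j xs! eᵢ eⱼ)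

unique-++⇒disjoint : (xs : List A) {ys : List A} → List.Unique (xs ++ ys) → Disjoint xs ys
unique-++⇒disjoint (x ∷ xs) (x∉ ∷ _)   (here refl , v∈ys)  = All.lookup x∉ (∈-++⁺ʳ xs v∈ys) refl
unique-++⇒disjoint (x ∷ xs) (_ ∷ xs!) (there v∈xs , v∈ys) = unique-++⇒disjoint xs xs! (v∈xs , v∈ys)

take-drop-disjoint : ∀ k {xs : List A} → List.Unique xs → Disjoint (take k xs) (drop k xs)
take-drop-disjoint k {xs} xs! =
  unique-++⇒disjoint (take k xs) (subst List.Unique (sym (take++drop≡id k xs)) xs!)

unique-reverse : {xs : List A} → List.Unique xs → List.Unique (reverse xs)
unique-reverse {xs = xs} = Permutationₛ.Unique-resp-↭ (setoid _) (↭⇒↭ₛ (↭-sym (↭-reverse xs)))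

Unique-toList⁺ : {v : Vec A c} → Unique v → List.Unique (toList v)
Unique-toList⁺ []         = []
Unique-toList⁺ (x∉ ∷ v!) = Allᵥ.toList⁺ x∉ ∷ Unique-toList⁺ v!

Unique-toList⁻ : {v : Vec A c} → List.Unique (toList v) → Unique v
Unique-toList⁻ {v = []}    []         = []
Unique-toList⁻ {v = _ ∷ _} (x∉ ∷ v!) = Allᵥ.toList⁻ x∉ ∷ Unique-toList⁻ v!

toList-cast-fromList : (ws : List A) (len : length ws ≡ c) → toList (cast len (fromList ws)) ≡ ws
toList-cast-fromList ws len = trans (toList-cast len (fromList ws)) (toList∘fromList ws)

lookup-removeAt : (xs : Vec A (suc c)) (i : Fin (suc c)) (a : Fin c) →
                  lookup (removeAt xs i) a ≡ lookup xs (punchIn i a)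
lookup-removeAt xs i a =
  trans (cong (lookup (removeAt xs i)) (sym (punchOut-punchIn i)))
        (removeAt-punchOut xs (punchInᵢ≢i i a ∘ sym))

∈-removeAt⁻ : (xs : Vec A (suc c)) (i : Fin (suc c)) {x : A} → x ∈ᵥ removeAt xs i → x ∈ᵥ xs
∈-removeAt⁻ xs i x∈ =
  subst (_∈ᵥ xs) (sym (trans (lookup-index x∈) (lookup-removeAt xs i (index x∈)))) (∈-lookup _ xs)

∈-removeAt⁺ : (xs : Vec A (suc c)) (i : Fin (suc c)) {x : A} →
              x ∈ᵥ xs → x ≢ lookup xs i → x ∈ᵥ removeAt xs i
∈-removeAt⁺ xs i x∈ x≢ =
  subst (_∈ᵥ removeAt xs i) (trans (removeAt-punchOut xs i≢) (sym (lookup-index x∈)))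
        (∈-lookup _ (removeAt xs i))
  where
  i≢ : i ≢ index x∈
  i≢ refl = x≢ (lookup-index x∈)

removeAt-injective : (xs : Vec A (suc c)) (i : Fin (suc c)) →
                     Injective _≡_ _≡_ (lookup xs) → Injective _≡_ _≡_ (lookup (removeAt xs i))
removeAt-injective xs i inj {a} {b} e =
  punchIn-injective i a b (inj (trans (sym (lookup-removeAt xs i a)) (trans e (lookup-removeAt xs i b))))

lookup∉removeAt : (xs : Vec A (suc c)) (i : Fin (suc c)) →
                  Injective _≡_ _≡_ (lookup xs) → lookup xs i ∉ᵥ removeAt xs i
lookup∉removeAt xs i inj x∈ =
  punchInᵢ≢i i (index x∈) (sym (inj (trans (lookup-index x∈) (lookup-removeAt xs i (index x∈)))))

-- Lehmer codes and arrangements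

LehmerCode : ℕ → Set
LehmerCode zero    = ⊤
LehmerCode (suc c) = Fin (suc c) × LehmerCode c

LehmerCode↔Fin! : ∀ c → LehmerCode c ↔ Fin (c !)
LehmerCode↔Fin! zero    = mk↔ₛ′ (λ _ → zero) (λ _ → tt) (λ { zero → refl }) (λ _ → refl)
LehmerCode↔Fin! (suc c) = ↔-trans (↔-refl ×-↔ LehmerCode↔Fin! c) (↔-sym *↔×)

arrangement : Vec A c → LehmerCode c → List A
arrangement {c = zero}  _  _       = []
arrangement {c = suc _} xs (i , k) = lookup xs i ∷ arrangement (removeAt xs i) k

length-arrangement : (xs : Vec A c) (k : LehmerCode c) → length (arrangement xs k) ≡ c
length-arrangement {c = zero}  _  _       = refl
length-arrangement {c = suc _} xs (i , k) = cong suc (length-arrangement (removeAt xs i) k)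

arrangement-⊆ : (xs : Vec A c) (k : LehmerCode c) {x : A} → x ∈ arrangement xs k → x ∈ᵥ xs
arrangement-⊆ {c = suc _} xs (i , k) (here refl) = ∈-lookup i xs
arrangement-⊆ {c = suc _} xs (i , k) (there x∈) = ∈-removeAt⁻ xs i (arrangement-⊆ (removeAt xs i) k x∈)

arrangement-unique : (xs : Vec A c) → Injective _≡_ _≡_ (lookup xs) →
                     (k : LehmerCode c) → List.Unique (arrangement xs k)
arrangement-unique {c = zero}  _  _   _       = []
arrangement-unique {c = suc _} xs inj (i , k) =
  All.tabulate (λ y∈ e →
    lookup∉removeAt xs i inj (subst (_∈ᵥ _) (sym e) (arrangement-⊆ (removeAt xs i) k y∈)))
  ∷ arrangement-unique (removeAt xs i) (removeAt-injective xs i inj) k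

arrangement-injective : (xs : Vec A c) → Injective _≡_ _≡_ (lookup xs) →
                        Injective _≡_ _≡_ (arrangement xs)
arrangement-injective {c = zero}  _  _   _ = refl
arrangement-injective {c = suc _} xs inj {i , k} {i′ , k′} e with refl ← inj (∷-injectiveˡ e) =
  cong (i ,_) (arrangement-injective (removeAt xs i) (removeAt-injective xs i inj) (∷-injectiveʳ e))

arrangement-surjective : (xs : Vec A c) (ys : List A) →
                         length ys ≡ c → List.Unique ys → All (_∈ᵥ xs) ys → ∃ λ k → arrangement xs k ≡ ys
arrangement-surjective {c = zero}  _  []       _   _          _          = tt , refl
arrangement-surjective {c = suc _} xs (y ∷ ys) len (y∉ ∷ ys!) (y∈ ∷ ys⊆)
  with k , e ← arrangement-surjective (removeAt xs (index y∈)) ys (suc-injective len) ys!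
      (All.zipWith (λ (y≢ , z∈) → ∈-removeAt⁺ xs _ z∈ (λ z≡ → y≢ (trans (lookup-index y∈) (sym z≡))))
                   (y∉ , ys⊆))
  = (index y∈ , k) , cong₂ _∷_ (sym (lookup-index y∈)) e

does≡true⇒ : (a? : Dec A) → does a? ≡ true → A
does≡true⇒ (yes a) _ = a

firstFrom≡just⇒ : ∀ s k (f : ℕ → Bool) {j} → firstFrom s k f ≡ just j →
                  f j ≡ true × s ≤ j × j < s + k
firstFrom≡just⇒ s (suc k) f {j} e with f s in fs
... | true  with refl ← just-injective e = fs , ≤-refl , m<m+n s 0<1+n
... | false with fj , s<j , j<s+k ← firstFrom≡just⇒ (suc s) k f e =
  fj , <⇒≤ s<j , subst (j <_) (sym (+-suc s k)) j<s+k

firstFrom-least : ∀ s k (f : ℕ → Bool) {j} → s ≤ j → j < s + k → f j ≡ true →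
                  (∀ i → s ≤ i → i < j → f i ≡ false) → firstFrom s k f ≡ just j
firstFrom-least s zero    f {j} s≤j j<s+0 _ _ =
  contradiction (subst (j <_) (+-identityʳ s) j<s+0) (≤⇒≯ s≤j)
firstFrom-least s (suc k) f {j} s≤j j<s+k fj below with f s in fs | m≤n⇒m<n∨m≡n s≤j
... | true  | inj₂ refl = refl
... | true  | inj₁ s<j  = contradiction (trans (sym fs) (below s ≤-refl s<j)) λ ()
... | false | inj₂ refl = contradiction (trans (sym fs) fj) λ ()
... | false | inj₁ s<j  =
  firstFrom-least (suc s) k f s<j (subst (j <_) (+-suc s k) j<s+k) fj
    (λ i s<i i<j → below i (<⇒≤ s<i) i<j)

firstFrom-cong : ∀ s k {f g : ℕ → Bool} → (∀ i → i < s + k → f i ≡ g i) →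
                 firstFrom s k f ≡ firstFrom s k g
firstFrom-cong s zero    _   = refl
firstFrom-cong s (suc k) {f} {g} f≗g with f s | g s | f≗g s (m<m+n s 0<1+n)
... | true  | .true  | refl = refl
... | false | .false | refl =
  firstFrom-cong (suc s) k (λ i i<1+s+k → f≗g i (subst (i <_) (sym (+-suc s k)) i<1+s+k))

⇔⇒↔ : {B : Set} → Irrelevant A → Irrelevant B → A ⇔ B → A ↔ B
⇔⇒↔ A-irr B-irr A⇔B =
  mk↔ₛ′ (Equivalence.to A⇔B) (Equivalence.from A⇔B) (λ _ → B-irr _ _) (λ _ → A-irr _ _)

Σ-≤-suc : (F : ℕ → Set) (m : ℕ) →
          Σ ℕ (λ j → F j × j ≤ suc m) ↔ (Σ ℕ (λ j → F j × j ≤ m) ⊎ F (suc m))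
Σ-≤-suc F m = mk↔ₛ′ to from to∘from from∘to
  where
  to : Σ ℕ (λ j → F j × j ≤ suc m) → Σ ℕ (λ j → F j × j ≤ m) ⊎ F (suc m)
  to (j , x , j≤1+m) with m≤n⇒m<n∨m≡n j≤1+m
  ... | inj₁ j<1+m = inj₁ (j , x , s≤s⁻¹ j<1+m)
  ... | inj₂ refl  = inj₂ x
  from : Σ ℕ (λ j → F j × j ≤ m) ⊎ F (suc m) → Σ ℕ (λ j → F j × j ≤ suc m)
  from (inj₁ (j , x , j≤m)) = j , x , m≤n⇒m≤1+n j≤m
  from (inj₂ x)             = suc m , x , ≤-refl
  to∘from : ∀ y → to (from y) ≡ y
  to∘from (inj₁ (j , x , j≤m)) with m≤n⇒m<n∨m≡n (m≤n⇒m≤1+n j≤m)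
  ... | inj₁ _    = cong (λ j≤m → inj₁ (j , x , j≤m)) (≤-irrelevant _ _)
  ... | inj₂ refl = contradiction j≤m 1+n≰n
  to∘from (inj₂ x) with m≤n⇒m<n∨m≡n (≤-refl {suc m})
  ... | inj₁ 1+m<1+m = contradiction 1+m<1+m (<-irrefl refl)
  ... | inj₂ refl    = refl
  from∘to : ∀ y → from (to y) ≡ y
  from∘to (j , x , j≤1+m) with m≤n⇒m<n∨m≡n j≤1+m
  ... | inj₁ _    = cong (λ j≤1+m → j , x , j≤1+m) (≤-irrelevant _ _)
  ... | inj₂ refl = cong (λ j≤1+m → j , x , j≤1+m) (≤-irrelevant _ _)

Σ↔Fin-factSum : (F : ℕ → Set) (m : ℕ) → (∀ {j} → F j → 1 ≤ j × j ≤ m) →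
                (∀ j → 1 ≤ j → j ≤ m → F j ↔ Fin (j !)) → Σ ℕ F ↔ Fin (factSum m)
Σ↔Fin-factSum F m range count = ↔-trans bound (bounded-count m ≤-refl)
  where
  bound : Σ ℕ F ↔ Σ ℕ (λ j → F j × j ≤ m)
  bound = mk↔ₛ′ (λ (j , x) → j , x , proj₂ (range x)) (λ (j , x , _) → j , x)
                (λ (j , x , _) → cong (λ j≤m → j , x , j≤m) (≤-irrelevant _ _)) (λ _ → refl)
  bounded-count : ∀ k → k ≤ m → Σ ℕ (λ j → F j × j ≤ k) ↔ Fin (factSum k)
  bounded-count zero    _     = mk↔ₛ′ empty (λ ()) (λ ()) (λ y → empty y)
    where
    empty : ∀ {B : Set} → Σ ℕ (λ j → F j × j ≤ 0) → B
    empty (_ , x , z≤n) = contradiction (proj₁ (range x)) λ ()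
  bounded-count (suc k) 1+k≤m =
    ↔-trans (Σ-≤-suc F k)
            (↔-trans (bounded-count k (<⇒≤ 1+k≤m) ⊎-↔ count (suc k) (s≤s z≤n) 1+k≤m) (↔-sym +↔⊎))

word-unique : (p : Perm n) → List.Unique (word p)
word-unique (_ , w!) = Unique-toList⁺ (toWitness w!)

length-word : (p : Perm n) → length (word p) ≡ n
length-word (w , _) = length-toList w

word-injective : {p q : Perm n} → word p ≡ word q → p ≡ q
word-injective {p = v , v!} {w , w!} e
  with refl ← trans (sym (cast-is-id refl v)) (toList-injective refl v w e) =
  cong (v ,_) (T-irrelevant v! w!)

fromWord : (ws : List (Fin n)) → length ws ≡ n → List.Unique ws → Perm n
fromWord ws len ws! =
  cast len (fromList ws) ,
  fromWitness (Unique-toList⁻ (subst List.Unique (sym (toList-cast-fromList ws len)) ws!))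

word-fromWord : (ws : List (Fin n)) (len : length ws ≡ n) (ws! : List.Unique ws) →
                word (fromWord ws len ws!) ≡ ws
word-fromWord ws len _ = toList-cast-fromList ws len

-- n distinct symbols out of n exhaust them: otherwise punching out the missing one
-- would embed Fin n into Fin (n - 1).
∈-word : (p : Perm n) (x : Fin n) → x ∈ word p
∈-word {suc m} (w , w!) x with any? (λ i → lookup w i ≟ x)
... | yes (i , refl) = ∈-toList⁺ (∈-lookup i w)
... | no x∉w = contradiction (injective⇒≤ punchOut-lookup-injective) 1+n≰n
  where
  x≢lookup : ∀ i → x ≢ lookup w i
  x≢lookup i e = x∉w (i , sym e)
  punchOut-lookup : Fin (suc m) → Fin m
  punchOut-lookup i = punchOut (x≢lookup i)
  punchOut-lookup-injective : Injective _≡_ _≡_ punchOut-lookup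
  punchOut-lookup-injective e =
    lookup-injective (toWitness w!) _ _ (punchOut-injective (x≢lookup _) (x≢lookup _) e)

-- Weights are overlaps

Overlap : ℕ → Perm n → Perm n → Set
Overlap {n} j p q = drop j (word p) ≡ take (n ∸ j) (word q)

overlap? : ∀ j (p q : Perm n) → Dec (Overlap j p q)
overlap? j p q = ≡-dec _≟_ _ _

≤∸1⇒< : ∀ {j} → 1 ≤ j → j ≤ n ∸ 1 → j < n
≤∸1⇒< {n = zero}  (s≤s _) ()
≤∸1⇒< {n = suc _} _       j≤n = s≤s j≤n

-- Two overlaps would place the first symbol of q at two positions of p.
overlap-unique : ∀ {i j} {p q : Perm n} → i < j → j < n → Overlap i p q → Overlap j p q → ⊥
overlap-unique {n} {i} {j} {p} {q} i<j j<n ovᵢ ovⱼ with word q | length-word q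
... | []     | refl = contradiction j<n λ ()
... | y ∷ ys | _ with n ∸ i | m<n⇒0<n∸m (<-trans i<j j<n) | n ∸ j | m<n⇒0<n∸m j<n
...   | suc _ | _ | suc _ | _ = <⇒≢ i<j (unique-drop-∷ i j (word-unique p) ovᵢ ovⱼ)

weight≡just⇒range : ∀ {j} (p q : Perm n) → weight p q ≡ just j → 1 ≤ j × j ≤ n ∸ 1
weight≡just⇒range {n} p q e with _ , 1≤j , j<n ← firstFrom≡just⇒ 1 (n ∸ 1) (overlaps p q) e =
  1≤j , s≤s⁻¹ j<n

weight≡just⇒overlap : ∀ {j} (p q : Perm n) → weight p q ≡ just j → Overlap j p q
weight≡just⇒overlap {n} {j} p q e =
  does≡true⇒ (overlap? j p q) (proj₁ (firstFrom≡just⇒ 1 (n ∸ 1) (overlaps p q) e))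

Overlap⇒weight≡just : ∀ {j} (p q : Perm n) → 1 ≤ j → j ≤ n ∸ 1 →
                      Overlap j p q → weight p q ≡ just j
Overlap⇒weight≡just {n} {j} p q 1≤j j≤n∸1 ov =
  firstFrom-least 1 (n ∸ 1) (overlaps p q) 1≤j (s≤s j≤n∸1) (dec-true (overlap? j p q) ov)
    (λ i _ i<j → dec-false (overlap? i p q)
                   (λ ovᵢ → overlap-unique {p = p} {q} i<j (≤∸1⇒< 1≤j j≤n∸1) ovᵢ ov))

-- Reversing words reverses arcs

length-reverse-word : (p : Perm n) → length (reverse (word p)) ≡ n
length-reverse-word p = trans (length-reverse (word p)) (length-word p)

reversePerm : Perm n → Perm n
reversePerm p = fromWord (reverse (word p)) (length-reverse-word p) (unique-reverse (word-unique p))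

word-reversePerm : (p : Perm n) → word (reversePerm p) ≡ reverse (word p)
word-reversePerm p =
  word-fromWord (reverse (word p)) (length-reverse-word p) (unique-reverse (word-unique p))

reversePerm-involutive : (p : Perm n) → reversePerm (reversePerm p) ≡ p
reversePerm-involutive p = word-injective (begin
  word (reversePerm (reversePerm p)) ≡⟨ word-reversePerm (reversePerm p) ⟩
  reverse (word (reversePerm p))     ≡⟨ cong reverse (word-reversePerm p) ⟩
  reverse (reverse (word p))         ≡⟨ reverse-involutive (word p) ⟩
  word p                             ∎)
  where open ≡-Reasoning

reversePerm↔ : Perm n ↔ Perm n
reversePerm↔ = mk↔ₛ′ reversePerm reversePerm reversePerm-involutive reversePerm-involutive

overlap-reverse : ∀ {j} {p q : Perm n} → j ≤ n →
                  Overlap j p q → Overlap j (reversePerm q) (reversePerm p)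
overlap-reverse {n} {j} {p} {q} j≤n ov = begin
  drop j (word (reversePerm q))
    ≡⟨ cong (drop j) (word-reversePerm q) ⟩
  drop j (reverse (word q))
    ≡⟨ cong (λ k → drop k (reverse (word q))) (m∸[m∸n]≡n j≤n) ⟨
  drop (n ∸ (n ∸ j)) (reverse (word q))
    ≡⟨ cong (λ m → drop (m ∸ (n ∸ j)) (reverse (word q))) (length-word q) ⟨
  drop (length (word q) ∸ (n ∸ j)) (reverse (word q))
    ≡⟨ reverse-take (n ∸ j) (word q) ⟨
  reverse (take (n ∸ j) (word q))
    ≡⟨ cong reverse ov ⟨
  reverse (drop j (word p))
    ≡⟨ reverse-drop j (word p) ⟩
  take (length (word p) ∸ j) (reverse (word p))
    ≡⟨ cong (λ m → take (m ∸ j) (reverse (word p))) (length-word p) ⟩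
  take (n ∸ j) (reverse (word p))
    ≡⟨ cong (take (n ∸ j)) (word-reversePerm p) ⟨
  take (n ∸ j) (word (reversePerm p)) ∎
  where open ≡-Reasoning

overlap-reverse⇔ : ∀ {j} (p q : Perm n) → j ≤ n →
                   Overlap j p q ⇔ Overlap j (reversePerm q) (reversePerm p)
overlap-reverse⇔ {j = j} p q j≤n = mk⇔ (overlap-reverse {p = p} {q} j≤n)
  (subst₂ (Overlap j) (reversePerm-involutive p) (reversePerm-involutive q)
   ∘ overlap-reverse {p = reversePerm q} {reversePerm p} j≤n)

weight-reverse : (p q : Perm n) → weight p q ≡ weight (reversePerm q) (reversePerm p)
weight-reverse {n} p q = firstFrom-cong 1 (n ∸ 1) λ j j<n →
  does-⇔ (overlap-reverse⇔ p q (≤-trans (s≤s⁻¹ j<n) (m∸n≤m n 1)))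
         (overlap? j p q) (overlap? j (reversePerm q) (reversePerm p))

-- Counting arcs

module _ (p : Perm n) {j : ℕ} (j≤n : j ≤ n) where
  private
    prefix suffix : List (Fin n)
    prefix = take j (word p)
    suffix = drop j (word p)

    prefixᵛ : Vec (Fin n) (length prefix)
    prefixᵛ = fromList prefix

    length-prefix : length prefix ≡ j
    length-prefix =
      trans (length-take j (word p)) (m≤n⇒m⊓n≡m (subst (j ≤_) (sym (length-word p)) j≤n))

    length-suffix : length suffix ≡ n ∸ j
    length-suffix = trans (length-drop j (word p)) (cong (_∸ j) (length-word p))

    lookup-prefixᵛ-injective : Injective _≡_ _≡_ (lookup prefixᵛ)
    lookup-prefixᵛ-injective = lookup-injective
      (Unique-toList⁻ (subst List.Unique (sym (toList∘fromList prefix)) (take⁺ j (word-unique p)))) _ _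

    extensionWord : LehmerCode (length prefix) → List (Fin n)
    extensionWord k = suffix ++ arrangement prefixᵛ k

    length-extensionWord : ∀ k → length (extensionWord k) ≡ n
    length-extensionWord k = begin
      length (suffix ++ arrangement prefixᵛ k)         ≡⟨ length-++ suffix ⟩
      length suffix + length (arrangement prefixᵛ k)
        ≡⟨ cong₂ _+_ length-suffix (trans (length-arrangement prefixᵛ k) length-prefix) ⟩
      (n ∸ j) + j                                      ≡⟨ m∸n+n≡m j≤n ⟩
      n                                                ∎
      where open ≡-Reasoning

    extensionWord-unique : ∀ k → List.Unique (extensionWord k)
    extensionWord-unique k =
      ++⁺ (drop⁺ j (word-unique p)) (arrangement-unique prefixᵛ lookup-prefixᵛ-injective k)
      λ (z∈suffix , z∈arrangement) →
        take-drop-disjoint j (word-unique p)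
          (∈-fromList⁻ (arrangement-⊆ prefixᵛ k z∈arrangement) , z∈suffix)

    extension : LehmerCode (length prefix) → Perm n
    extension k = fromWord (extensionWord k) (length-extensionWord k) (extensionWord-unique k)

    word-extension : ∀ k → word (extension k) ≡ suffix ++ arrangement prefixᵛ k
    word-extension k = word-fromWord (extensionWord k) (length-extensionWord k) (extensionWord-unique k)

    extension-overlap : ∀ k → Overlap j p (extension k)
    extension-overlap k = sym (begin
      take (n ∸ j) (word (extension k))                     ≡⟨ cong (take (n ∸ j)) (word-extension k) ⟩
      take (n ∸ j) (suffix ++ arrangement prefixᵛ k)
        ≡⟨ cong (λ m → take m (suffix ++ arrangement prefixᵛ k)) length-suffix ⟨
      take (length suffix) (suffix ++ arrangement prefixᵛ k) ≡⟨ take-length-++ suffix _ ⟩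
      suffix                                                ∎)
      where open ≡-Reasoning

    extension-injective : Injective _≡_ _≡_ extension
    extension-injective {k} {k′} e = arrangement-injective prefixᵛ lookup-prefixᵛ-injective
      (++-cancelˡ suffix _ _ (trans (sym (word-extension k)) (trans (cong word e) (word-extension k′))))

    -- q = suffix ++ rest, and rest avoids suffix, so it is an arrangement of prefix.
    extension-surjective : ∀ q → Overlap j p q → ∃ λ k → extension k ≡ q
    extension-surjective q ov =
      k , word-injective (trans (word-extension k) (trans (cong (suffix ++_) arrangement≡rest) (sym word-q)))
      where
      rest : List (Fin n)
      rest = drop (n ∸ j) (word q)

      word-q : word q ≡ suffix ++ rest
      word-q = trans (sym (take++drop≡id (n ∸ j) (word q))) (cong (_++ rest) (sym ov))

      length-rest : length rest ≡ length prefix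
      length-rest = trans (length-drop (n ∸ j) (word q))
        (trans (cong (_∸ (n ∸ j)) (length-word q)) (trans (m∸[m∸n]≡n j≤n) (sym length-prefix)))

      ∈-prefix : ∀ {z} → z ∈ rest → z ∈ prefix ⊎ z ∈ suffix → z ∈ᵥ prefixᵛ
      ∈-prefix _        (inj₁ z∈prefix) = ∈-fromList⁺ z∈prefix
      ∈-prefix z∈rest (inj₂ z∈suffix) =
        ⊥-elim (take-drop-disjoint (n ∸ j) (word-unique q) (subst (_ ∈_) ov z∈suffix , z∈rest))

      rest⊆prefix : All (_∈ᵥ prefixᵛ) rest
      rest⊆prefix = All.tabulate λ {z} z∈rest →
        ∈-prefix z∈rest (∈-++⁻ prefix (subst (z ∈_) (sym (take++drop≡id j (word p))) (∈-word p z)))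

      rest-arrangement : ∃ λ k → arrangement prefixᵛ k ≡ rest
      rest-arrangement =
        arrangement-surjective prefixᵛ rest length-rest (drop⁺ (n ∸ j) (word-unique q)) rest⊆prefix

      k : LehmerCode (length prefix)
      k = proj₁ rest-arrangement

      arrangement≡rest : arrangement prefixᵛ k ≡ rest
      arrangement≡rest = proj₂ rest-arrangement

  overlap-count : Σ (Perm n) (Overlap j p) ↔ Fin (j !)
  overlap-count =
    ↔-trans (↔-sym (⤖⇒↔ (mk⤖ (to-injective , strictlySurjective⇒surjective to-surjective))))
            (↔-trans (LehmerCode↔Fin! (length prefix)) (K-reflexive (cong (Fin ∘ _!) length-prefix)))
    where
    to : LehmerCode (length prefix) → Σ (Perm n) (Overlap j p)
    to k = extension k , extension-overlap k
    to-injective : Injective _≡_ _≡_ to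
    to-injective = extension-injective ∘ cong proj₁
    to-surjective : ∀ y → ∃ λ k → to k ≡ y
    to-surjective (q , ov) with k , refl ← extension-surjective q ov = k , cong (q ,_) (uip _ _)

out-count : ∀ {j} (p : Perm n) → 1 ≤ j → j ≤ n ∸ 1 →
            Σ (Perm n) (λ q → weight p q ≡ just j) ↔ Fin (j !)
out-count {n} {j} p 1≤j j≤n∸1 =
  ↔-trans (Σ-↔ ↔-refl (λ {q} → ⇔⇒↔ uip uip (weight⇔overlap q)))
          (overlap-count p (≤-trans j≤n∸1 (m∸n≤m n 1)))
  where
  weight⇔overlap : ∀ q → (weight p q ≡ just j) ⇔ Overlap j p q
  weight⇔overlap q = mk⇔ (weight≡just⇒overlap p q) (Overlap⇒weight≡just p q 1≤j j≤n∸1)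

in-count : ∀ {j} (p : Perm n) → 1 ≤ j → j ≤ n ∸ 1 →
           Σ (Perm n) (λ q → weight q p ≡ just j) ↔ Fin (j !)
in-count {j = j} p 1≤j j≤n∸1 =
  ↔-trans (Σ-↔ reversePerm↔ (λ {q} → K-reflexive (cong (_≡ just j) (weight-reverse q p))))
          (out-count (reversePerm p) 1≤j j≤n∸1)

proposition18 : (n : ℕ) → 2 ≤ n → (p : Perm n) →
    ((j : ℕ) → 1 ≤ j → j ≤ n ∸ 1 →
      (Σ (Perm n) (λ q → weight q p ≡ just j) ↔ Fin (j !))
      × (Σ (Perm n) (λ q → weight p q ≡ just j) ↔ Fin (j !)))
    × (Σ (Perm n) (λ q → ∃ (λ j → weight q p ≡ just j)) ↔ Fin (factSum (n ∸ 1)))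
    × (Σ (Perm n) (λ q → ∃ (λ j → weight p q ≡ just j)) ↔ Fin (factSum (n ∸ 1)))
proposition18 n _ p =
    (λ j 1≤j j≤n∸1 → in-count p 1≤j j≤n∸1 , out-count p 1≤j j≤n∸1)
  , ↔-trans (∃∃↔∃∃ (λ q j → weight q p ≡ just j))
            (Σ↔Fin-factSum _ (n ∸ 1) (λ (q , e) → weight≡just⇒range q p e) (λ _ → in-count p))
  , ↔-trans (∃∃↔∃∃ (λ q j → weight p q ≡ just j))
            (Σ↔Fin-factSum _ (n ∸ 1) (λ (q , e) → weight≡just⇒range p q e) (λ _ → out-count p))
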